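{- Let $\psi$ and $G_\psi$ be as constructed below. Then $G_\psi$ has a Pareto-optimal matching $M$ with $\mathsf{cost}(M)=0$ if and only if $\psi$ is satisfiable.
   Context: Matchings and preferences: node $u$ prefers matching $M$ to $N$ if $u$ is matched in $M$ and unmatched in $N$, or matched in both and prefers its partner in $M$; $\phi(M,N)$ is the number of nodes preferring $M$ to $N$. A matching $M$ is Pareto-optimal if there is no matching $N$ with $\phi(N,M)>0$ and $\phi(M,N)=0$. $\mathsf{cost}(M)=\sum_{e\in M}\mathsf{cost}(e)$. The formula: $\psi_0$ is a 3-CNF formula over $X_1,\ldots,X_n$, each clause having three literals on distinct variables. $\psi$ is obtained by replacing every occurrence of $\neg X_i$ by a new variable $X_{n+i}$ and adding clauses $(X_i\vee X_{n+i})$ and $(\neg X_i\vee\neg X_{n+i})$ for each $i\in[n]$. Clauses of $\psi$ containing only unnegated variables are positive (2 or 3 literals); the others are the negative clauses $(\neg X_i\vee\neg X_{n+i})$; each variable occurs negated exactly once. The graph $G_\psi$ (bipartite; nodes named $a,a',c,c'$ on one side, $b,b',d,d'$ on the other): for each positive clause $C_\ell$ and each variable $x$ in it, nodes $a_{x,\ell},a'_{x,\ell},b_{x,\ell},b'_{x,\ell}$ with gadget edges $(a_{x,\ell},b_{x,\ell}),(a_{x,\ell},b'_{x,\ell}),(a'_{x,\ell},b_{x,\ell}),(a'_{x,\ell},b'_{x,\ell})$. For each variable $r$, nodes $c_r,c'_r,d_r,d'_r$ with gadget edges $(c_r,d_r),(c_r,d'_r),(c'_r,d_r),(c'_r,d'_r)$.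 For a positive clause $C_\ell$ with variables in a fixed cyclic order $v_1,\ldots,v_k$ ($k\in\{2,3\}$, indices mod $k$), add edges $(a_{v_j,\ell},b_{v_{j-1},\ell})$. For a negative clause $\neg x\vee\neg y$, add edges $(c_x,d_y),(c_y,d_x)$. For each occurrence of $x$ in a positive clause $C_\ell$, add consistency edges $(a_{x,\ell},d'_x)$ and $(c_x,b'_{x,\ell})$. Preferences (most preferred first): $a_{v_j,\ell}$: $b_{v_{j-1},\ell}\succ b_{v_j,\ell}\succ d'_{v_j}\succ b'_{v_j,\ell}$; $a'_{v_j,\ell}$: $b_{v_j,\ell}\succ b'_{v_j,\ell}$; $b_{v_j,\ell}$: $a_{v_{j+1},\ell}\succ a_{v_j,\ell}\succ a'_{v_j,\ell}$; $b'_{v_j,\ell}$: $a'_{v_j,\ell}\succ c_{v_j}\succ a_{v_j,\ell}$. For the negative clause $\neg x\vee\neg y$ (and symmetrically with $x,y$ swapped): $c_x$: $d_y\succ d_x\succ$ (all $b'_{x,\ell}$ over positive occurrences of $x$, in any order) $\succ d'_x$; $c'_x$: $d_x\succ d'_x$; $d_x$: $c_y\succ c_x\succ c'_x$; $d'_x$: $c'_x\succ$ (all $a_{x,\ell}$, in any order) $\succ c_x$. Edge costs: $\mathsf{cost}(e)=0$ for the four gadget edges of each $\{a_{x,\ell},a'_{x,\ell},b_{x,\ell},b'_{x,\ell}\}$ and each $\{c_r,c'_r,d_r,d'_r\}$; $\mathsf{cost}(e)=1$ for all other edges. -}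

module Defs where

open import Data.Nat using (ℕ; zero; suc)
open import Data.Bool using (Bool; true; false; not; if_then_else_)
open import Data.Nat.ListAction using (sum)
import Data.Bool.Properties as BoolP
open import Data.Fin using (Fin; zero; suc)
import Data.Fin.Properties as FinP
open import Data.Fin.Properties using () renaming (_≟_ to _≟F_)
open import Data.Product using (Σ; ∃; ∃-syntax; _×_; _,_; proj₁; proj₂)
import Data.Product.Properties as ProdP
open import Data.Sum using (_⊎_; inj₁; inj₂)
import Data.Sum.Properties as SumP
open import Data.List using (List; []; _∷_; _++_; map; filter; concatMap; cartesianProduct)
open import Data.List.Membership.Propositional using (_∈_; _∉_)
open import Data.List.Relation.Unary.All using (All)
open import Data.List.Relation.Unary.Any using (Any)
open import Data.List.Relation.Unary.AllPairs using (AllPairs)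
open import Data.Fin.Base using () renaming (_↑ˡ_ to _↑ˡ_)
import Data.List as L
open import Relation.Binary.PropositionalEquality using (_≡_; _≢_)
open import Relation.Binary.Definitions using (DecidableEquality)
open import Relation.Nullary using (¬_; does)

-- A literal over variables V: (v , true) is v, (v , false) is ¬ v.
Literal : Set → Set
Literal V = V × Bool

Clause : Set → Set
Clause V = List (Literal V)

CNF : Set → Set
CNF V = List (Clause V)

Satisfiable : {V : Set} → CNF V → Set
Satisfiable {V} ψ =
  Σ (V → Bool) λ α → All (λ C → Any (λ l → α (proj₁ l) ≡ proj₂ l) C) ψ

CNF3 : ℕ → ℕ → Set
CNF3 n m = Fin m → Fin 3 → Literal (Fin n)

DistinctVars : {n m : ℕ} → CNF3 n m → Set
DistinctVars φ = ∀ ℓ j k → proj₁ (φ ℓ j) ≡ proj₁ (φ ℓ k) → j ≡ k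

-- Variables of ψ: (i , true) is X_i, (i , false) is X_{n+i}.

Var : ℕ → Set
Var n = Fin n × Bool

bar : {n : ℕ} → Var n → Var n
bar (i , p) = i , not p

-- the variable of ψ replacing a literal of ψ₀
-- (X_i ↦ X_i, ¬X_i ↦ X_{n+i}); with our encoding this is the identity
litVar : {n : ℕ} → Literal (Fin n) → Var n
litVar (i , p) = i , p

-- An occurrence is either (ℓ , j): the j-th variable of the translated
-- clause C_ℓ of ψ₀ (cyclic order v₀ v₁ v₂ as written), or (i , p): the
-- variable (i , p) in the clause (X_i ∨ X_{n+i}) (cyclic order X_i, X_{n+i}).

Occ : ℕ → ℕ → Set
Occ n m = (Fin m × Fin 3) ⊎ (Fin n × Bool)

_≟Var_ : {n : ℕ} → DecidableEquality (Var n)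
_≟Var_ = ProdP.≡-dec _≟F_ BoolP._≟_

_≟Occ_ : {n m : ℕ} → DecidableEquality (Occ n m)
_≟Occ_ = SumP.≡-dec (ProdP.≡-dec _≟F_ _≟F_) (ProdP.≡-dec _≟F_ BoolP._≟_)

prev3 : Fin 3 → Fin 3
prev3 zero = suc (suc zero)
prev3 (suc zero) = zero
prev3 (suc (suc zero)) = suc zero

next3 : Fin 3 → Fin 3
next3 zero = suc zero
next3 (suc zero) = suc (suc zero)
next3 (suc (suc zero)) = zero

prevOcc : {n m : ℕ} → Occ n m → Occ n m
prevOcc (inj₁ (ℓ , j)) = inj₁ (ℓ , prev3 j)
prevOcc (inj₂ (i , p)) = inj₂ (i , not p)

nextOcc : {n m : ℕ} → Occ n m → Occ n m
nextOcc (inj₁ (ℓ , j)) = inj₁ (ℓ , next3 j)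
nextOcc (inj₂ (i , p)) = inj₂ (i , not p)

occVar : {n m : ℕ} → CNF3 n m → Occ n m → Var n
occVar φ (inj₁ (ℓ , j)) = litVar (φ ℓ j)
occVar φ (inj₂ (i , p)) = i , p

allOcc : (n m : ℕ) → List (Occ n m)
allOcc n m =
  map inj₁ (cartesianProduct (L.allFin m) (L.allFin 3)) ++
  map inj₂ (cartesianProduct (L.allFin n) (true ∷ false ∷ []))

occsOf : {n m : ℕ} → CNF3 n m → Var n → List (Occ n m)
occsOf {n} {m} φ x = filter (λ o → occVar φ o ≟Var x) (allOcc n m)

posClause : {n m : ℕ} → CNF3 n m → Fin m → Clause (Var n)
posClause φ ℓ =
  (litVar (φ ℓ zero) , true) ∷ (litVar (φ ℓ (suc zero)) , true) ∷
  (litVar (φ ℓ (suc (suc zero))) , true) ∷ []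

consClause : {n : ℕ} → Fin n → Clause (Var n)
consClause i = ((i , true) , true) ∷ ((i , false) , true) ∷ []

negClause : {n : ℕ} → Fin n → Clause (Var n)
negClause i = ((i , true) , false) ∷ ((i , false) , false) ∷ []

psi : {n m : ℕ} → CNF3 n m → CNF (Var n)
psi {n} {m} φ =
  map (posClause φ) (L.allFin m) ++
  concatMap (λ i → consClause i ∷ negClause i ∷ []) (L.allFin n)

data LNode (n m : ℕ) : Set where
  a a' : Occ n m → LNode n m
  c c' : Var n → LNode n m

data RNode (n m : ℕ) : Set where
  b b' : Occ n m → RNode n m
  d d' : Var n → RNode n m

data Before {A : Set} (x y : A) : List A → Set where
  here  : ∀ {zs} → y ∈ zs → Before x y (x ∷ zs)
  there : ∀ {z zs} → Before x y zs → Before x y (z ∷ zs)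

-- The graph is parametrised by the two "in any order" choices:
-- σC x is the order in which c_x ranks the b'_{x,ℓ}, and
-- σD x is the order in which d'_x ranks the a_{x,ℓ}
-- (both required, in the theorem, to be permutations of occsOf φ x).
module Graph {n m : ℕ} (φ : CNF3 n m) (σC σD : Var n → List (Occ n m)) where

  -- preference lists, most preferred first; the neighbours of a node are
  -- exactly the members of its list
  prefL : LNode n m → List (RNode n m)
  prefL (a o)  = b (prevOcc o) ∷ b o ∷ d' (occVar φ o) ∷ b' o ∷ []
  prefL (a' o) = b o ∷ b' o ∷ []
  prefL (c x)  = d (bar x) ∷ d x ∷ (map b' (σC x) ++ (d' x ∷ []))
  prefL (c' x) = d x ∷ d' x ∷ []

  prefR : RNode n m → List (LNode n m)
  prefR (b o)  = a (nextOcc o) ∷ a o ∷ a' o ∷ []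
  prefR (b' o) = a' o ∷ c (occVar φ o) ∷ a o ∷ []
  prefR (d x)  = c (bar x) ∷ c x ∷ c' x ∷ []
  prefR (d' x) = c' x ∷ (map a (σD x) ++ (c x ∷ []))

  Edge : LNode n m → RNode n m → Set
  Edge u v = v ∈ prefL u

  cost : LNode n m × RNode n m → ℕ
  cost (a o  , b o')  = if does (o ≟Occ o') then 0 else 1
  cost (a o  , b' o') = if does (o ≟Occ o') then 0 else 1
  cost (a' o , b o')  = if does (o ≟Occ o') then 0 else 1
  cost (a' o , b' o') = if does (o ≟Occ o') then 0 else 1
  cost (c x  , d y)   = if does (x ≟Var y) then 0 else 1
  cost (c x  , d' y)  = if does (x ≟Var y) then 0 else 1
  cost (c' x , d y)   = if does (x ≟Var y) then 0 else 1
  cost (c' x , d' y)  = if does (x ≟Var y) then 0 else 1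
  cost _ = 1

  Matching : Set
  Matching = List (LNode n m × RNode n m)

  IsMatching : Matching → Set
  IsMatching M =
    All (λ e → Edge (proj₁ e) (proj₂ e)) M ×
    AllPairs (λ e f → proj₁ e ≢ proj₁ f × proj₂ e ≢ proj₂ f) M

  costM : Matching → ℕ
  costM M = sum (map cost M)

  PrefersL : Matching → Matching → LNode n m → Set
  PrefersL M N u =
    (∃[ v ] ((u , v) ∈ M × (∀ w → (u , w) ∉ N))) ⊎
    (∃[ v ] ∃[ w ] ((u , v) ∈ M × (u , w) ∈ N × Before v w (prefL u)))

  PrefersR : Matching → Matching → RNode n m → Set
  PrefersR M N v =
    (∃[ u ] ((u , v) ∈ M × (∀ w → (w , v) ∉ N))) ⊎
    (∃[ u ] ∃[ w ] ((u , v) ∈ M × (w , v) ∈ N × Before u w (prefR v)))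

  SomePrefers : Matching → Matching → Set
  SomePrefers M N = (∃[ u ] PrefersL M N u) ⊎ (∃[ v ] PrefersR M N v)

  ParetoOptimal : Matching → Set
  ParetoOptimal M =
    IsMatching M ×
    ¬ (∃[ N ] (IsMatching N × SomePrefers N M × ¬ SomePrefers M N))

{-# OPTIONS --safe #-}
module Submission where

-- Each gadget {a,a',b,b'} or {c,c',d,d'} has exactly two perfect matchings by zero-cost edges,
-- one for each truth value of its variable (c–d, a–b' mean true).
--
-- A satisfying assignment α picks one of them in every gadget.  If no node prefers this matching
-- Mα to a matching N, then, going through c', c, a', b' and a in turn, N gives every node its
-- Mα-partner; the only subtle case is a false a_o moving to b_{o-1}, which forces a_{o+1} to move
-- likewise and so on around the clause, making the clause false.  So nobody prefers N to Mα.
--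
-- Conversely, a Pareto-optimal matching is maximal, so with zero cost it is perfect on every
-- gadget, and reading off α x = [c_x–d_x] satisfies ψ, since each violated clause yields a
-- blocking exchange: two true complementary variables let c_x and c_x̄ swap their d-nodes; an
-- occurrence on a–b' of a false variable swaps with c_x–d'_x through the consistency edges; and if
-- all variables of a positive clause are false, each a rotates to the b of its cyclic predecessor.

open import Defs
open import Data.Bool using (Bool; true; false; not; if_then_else_)
import Data.Bool.Properties as Boolₚ
open import Data.Empty using (⊥; ⊥-elim)
open import Data.Fin using (Fin; zero; suc)
open import Data.Nat using (ℕ)
open import Data.Nat.ListAction using (sum)
open import Data.Nat.Properties using (m+n≡0⇒m≡0; m+n≡0⇒n≡0)
open import Data.List using (List; []; _∷_; _++_; map; filter; cartesianProduct; allFin)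
open import Data.List.Membership.Propositional using (_∈_; _∉_)
open import Data.List.Membership.Propositional.Properties
  using (∈-++⁺ˡ; ∈-++⁺ʳ; ∈-++⁻; ∈-map⁺; ∈-map⁻; ∈-filter⁺; ∈-filter⁻; ∈-allFin; ∈-cartesianProduct⁺; ∈-concatMap⁺)
import Data.List.Membership.DecPropositional as DecMembership
open import Data.List.Relation.Unary.All as All using (All; []; _∷_)
import Data.List.Relation.Unary.All.Properties as Allₚ
open import Data.List.Relation.Unary.Any as Any using (Any; here; there)
open import Data.List.Relation.Unary.AllPairs using (AllPairs; []; _∷_)
import Data.List.Relation.Unary.AllPairs as AllPairs
import Data.List.Relation.Unary.AllPairs.Properties as AllPairsₚ
open import Data.List.Relation.Unary.Unique.Propositional using (Unique)
import Data.List.Relation.Unary.Unique.Propositional.Properties as Uniqueₚ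
open import Data.List.Relation.Binary.Permutation.Propositional using (_↭_; ↭-sym; ↭⇒↭ₛ)
open import Data.List.Relation.Binary.Permutation.Propositional.Properties using (∈-resp-↭)
import Data.List.Relation.Binary.Permutation.Setoid.Properties as Permutationₛ
open import Data.Product using (∃-syntax; _×_; _,_; proj₁; proj₂)
open import Data.Sum using (_⊎_; inj₁; inj₂)
import Data.Sum.Properties as Sumₚ
open import Function.Bundles using (_⇔_; mk⇔; mk↣)
open import Relation.Binary.Definitions using (DecidableEquality)
open import Relation.Binary.PropositionalEquality using (_≡_; _≢_; refl; sym; trans; cong; subst; subst₂; setoid; module ≡-Reasoning)
open import Relation.Nullary using (¬_; Dec; yes; no; does; contradiction)
open import Relation.Nullary.Decidable using (¬?; decidable-stable; dec-true; via-injection)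

module _ {A : Set} where

  Before⇒∈ˡ : ∀ {x y : A} {xs} → Before x y xs → x ∈ xs
  Before⇒∈ˡ (here _)  = here refl
  Before⇒∈ˡ (there p) = there (Before⇒∈ˡ p)

  Before⇒∈ʳ : ∀ {x y : A} {xs} → Before x y xs → y ∈ xs
  Before⇒∈ʳ (here y∈zs) = there y∈zs
  Before⇒∈ʳ (there p)   = there (Before⇒∈ʳ p)

  Before-irrefl : ∀ {x : A} {xs} → Unique xs → ¬ Before x x xs
  Before-irrefl (x∉zs ∷ _)   (here x∈zs) = All.lookup x∉zs x∈zs refl
  Before-irrefl (_ ∷ unique) (there p)   = Before-irrefl unique p

  Before-asym : ∀ {x y : A} {xs} → Unique xs → Before x y xs → ¬ Before y x xs
  Before-asym (x∉zs ∷ _)   (here y∈zs) (here _)  = All.lookup x∉zs y∈zs refl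
  Before-asym (x∉zs ∷ _)   (here _)    (there q) = All.lookup x∉zs (Before⇒∈ʳ q) refl
  Before-asym (y∉zs ∷ _)   (there p)   (here _)  = All.lookup y∉zs (Before⇒∈ʳ p) refl
  Before-asym (_ ∷ unique) (there p)   (there q) = Before-asym unique p q

  Before-++ : ∀ {x y : A} xs {ys} → x ∈ xs → y ∈ ys → Before x y (xs ++ ys)
  Before-++ (_ ∷ xs) (here refl)  y∈ys = here (∈-++⁺ʳ xs y∈ys)
  Before-++ (_ ∷ xs) (there x∈xs) y∈ys = there (Before-++ xs x∈xs y∈ys)

  AllPairs-lookup : ∀ {R : A → A → Set} {xs x y} → AllPairs R xs → x ∈ xs → y ∈ xs →
                    x ≡ y ⊎ R x y ⊎ R y x
  AllPairs-lookup (_  ∷ _)  (here refl) (here refl) = inj₁ refl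
  AllPairs-lookup (Rx ∷ _)  (here refl) (there y∈)  = inj₂ (inj₁ (All.lookup Rx y∈))
  AllPairs-lookup (Ry ∷ _)  (there x∈)  (here refl) = inj₂ (inj₂ (All.lookup Ry x∈))
  AllPairs-lookup (_  ∷ Rs) (there x∈)  (there y∈)  = AllPairs-lookup Rs x∈ y∈

module _ {A : Set} (f : A → ℕ) where

  sum-map≡0⁺ : ∀ xs → (∀ {x} → x ∈ xs → f x ≡ 0) → sum (map f xs) ≡ 0
  sum-map≡0⁺ []       _     = refl
  sum-map≡0⁺ (x ∷ xs) zeros
    rewrite zeros (here refl) = sum-map≡0⁺ xs (λ x∈xs → zeros (there x∈xs))

  sum-map≡0⁻ : ∀ {xs x} → sum (map f xs) ≡ 0 → x ∈ xs → f x ≡ 0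
  sum-map≡0⁻ {y ∷ _} sum≡0 (here refl)  = m+n≡0⇒m≡0 (f y) sum≡0
  sum-map≡0⁻ {y ∷ _} sum≡0 (there x∈xs) = sum-map≡0⁻ (m+n≡0⇒n≡0 (f y) sum≡0) x∈xs

module _ {A B : Set} where

  _⊕_ : List A → List B → List (A ⊎ B)
  xs ⊕ ys = map inj₁ xs ++ map inj₂ ys

  ⊕-complete : ∀ {xs ys} → (∀ x → x ∈ xs) → (∀ y → y ∈ ys) → ∀ z → z ∈ xs ⊕ ys
  ⊕-complete {xs} ∈xs _ (inj₁ x) = ∈-++⁺ˡ (∈-map⁺ inj₁ (∈xs x))
  ⊕-complete {xs} _ ∈ys (inj₂ y) = ∈-++⁺ʳ (map inj₁ xs) (∈-map⁺ inj₂ (∈ys y))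

  ⊕-unique : ∀ {xs ys} → Unique xs → Unique ys → Unique (xs ⊕ ys)
  ⊕-unique xs! ys! =
    Uniqueₚ.++⁺ (Uniqueₚ.map⁺ Sumₚ.inj₁-injective xs!) (Uniqueₚ.map⁺ Sumₚ.inj₂-injective ys!) disjoint
    where
    disjoint : ∀ {xs ys} {z : A ⊎ B} → ¬ (z ∈ map inj₁ xs × z ∈ map inj₂ ys)
    disjoint (z∈₁ , z∈₂) with ∈-map⁻ inj₁ z∈₁ | ∈-map⁻ inj₂ z∈₂
    ... | _ , _ , refl | _ , _ , ()

bar≢ : {n : ℕ} (x : Var n) → bar x ≢ x
bar≢ (_ , true)  ()
bar≢ (_ , false) ()

bar-involutive : {n : ℕ} (x : Var n) → bar (bar x) ≡ x
bar-involutive (_ , true)  = refl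
bar-involutive (_ , false) = refl

module _ {n m : ℕ} where

  prevOcc-nextOcc : (o : Occ n m) → prevOcc (nextOcc o) ≡ o
  prevOcc-nextOcc (inj₁ (_ , zero))           = refl
  prevOcc-nextOcc (inj₁ (_ , suc zero))       = refl
  prevOcc-nextOcc (inj₁ (_ , suc (suc zero))) = refl
  prevOcc-nextOcc (inj₂ (_ , true))           = refl
  prevOcc-nextOcc (inj₂ (_ , false))          = refl

  nextOcc-prevOcc : (o : Occ n m) → nextOcc (prevOcc o) ≡ o
  nextOcc-prevOcc (inj₁ (_ , zero))           = refl
  nextOcc-prevOcc (inj₁ (_ , suc zero))       = refl
  nextOcc-prevOcc (inj₁ (_ , suc (suc zero))) = refl
  nextOcc-prevOcc (inj₂ (_ , true))           = refl
  nextOcc-prevOcc (inj₂ (_ , false))          = refl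

  prevOcc≢ : (o : Occ n m) → prevOcc o ≢ o
  prevOcc≢ (inj₁ (_ , zero))           ()
  prevOcc≢ (inj₁ (_ , suc zero))       ()
  prevOcc≢ (inj₁ (_ , suc (suc zero))) ()
  prevOcc≢ (inj₂ (_ , true))           ()
  prevOcc≢ (inj₂ (_ , false))          ()

  nextOcc≢ : (o : Occ n m) → nextOcc o ≢ o
  nextOcc≢ o eq = prevOcc≢ o (trans (cong prevOcc (sym eq)) (prevOcc-nextOcc o))

allVar : (n : ℕ) → List (Var n)
allVar n = cartesianProduct (allFin n) (true ∷ false ∷ [])

∈-bools : (p : Bool) → p ∈ true ∷ false ∷ []
∈-bools true  = here refl
∈-bools false = there (here refl)

bools-unique : Unique (true ∷ false ∷ [])
bools-unique = ((λ ()) ∷ []) ∷ [] ∷ []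

∈-allVar : {n : ℕ} (x : Var n) → x ∈ allVar n
∈-allVar (i , p) = ∈-cartesianProduct⁺ (∈-allFin i) (∈-bools p)

allVar-unique : (n : ℕ) → Unique (allVar n)
allVar-unique n = Uniqueₚ.cartesianProduct⁺ (Uniqueₚ.allFin⁺ n) bools-unique

∈-allOcc : {n m : ℕ} (o : Occ n m) → o ∈ allOcc n m
∈-allOcc = ⊕-complete (λ (ℓ , j) → ∈-cartesianProduct⁺ (∈-allFin ℓ) (∈-allFin j)) ∈-allVar

allOcc-unique : (n m : ℕ) → Unique (allOcc n m)
allOcc-unique n m =
  ⊕-unique (Uniqueₚ.cartesianProduct⁺ (Uniqueₚ.allFin⁺ m) (Uniqueₚ.allFin⁺ 3)) (allVar-unique n)

module _ {n m : ℕ} where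

  NodeCode : Set
  NodeCode = (Occ n m ⊎ Occ n m) ⊎ (Var n ⊎ Var n)

  _≟NodeCode_ : DecidableEquality NodeCode
  _≟NodeCode_ = Sumₚ.≡-dec (Sumₚ.≡-dec _≟Occ_ _≟Occ_) (Sumₚ.≡-dec _≟Var_ _≟Var_)

  encodeL : LNode n m → NodeCode
  encodeL (a o)  = inj₁ (inj₁ o)
  encodeL (a' o) = inj₁ (inj₂ o)
  encodeL (c x)  = inj₂ (inj₁ x)
  encodeL (c' x) = inj₂ (inj₂ x)

  decodeL : NodeCode → LNode n m
  decodeL (inj₁ (inj₁ o)) = a o
  decodeL (inj₁ (inj₂ o)) = a' o
  decodeL (inj₂ (inj₁ x)) = c x
  decodeL (inj₂ (inj₂ x)) = c' x

  decodeL-encodeL : ∀ u → decodeL (encodeL u) ≡ u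
  decodeL-encodeL (a _)  = refl
  decodeL-encodeL (a' _) = refl
  decodeL-encodeL (c _)  = refl
  decodeL-encodeL (c' _) = refl

  encodeL-decodeL : ∀ k → encodeL (decodeL k) ≡ k
  encodeL-decodeL (inj₁ (inj₁ _)) = refl
  encodeL-decodeL (inj₁ (inj₂ _)) = refl
  encodeL-decodeL (inj₂ (inj₁ _)) = refl
  encodeL-decodeL (inj₂ (inj₂ _)) = refl

  encodeR : RNode n m → NodeCode
  encodeR (b o)  = inj₁ (inj₁ o)
  encodeR (b' o) = inj₁ (inj₂ o)
  encodeR (d x)  = inj₂ (inj₁ x)
  encodeR (d' x) = inj₂ (inj₂ x)

  decodeR : NodeCode → RNode n m
  decodeR (inj₁ (inj₁ o)) = b o
  decodeR (inj₁ (inj₂ o)) = b' o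
  decodeR (inj₂ (inj₁ x)) = d x
  decodeR (inj₂ (inj₂ x)) = d' x

  decodeR-encodeR : ∀ v → decodeR (encodeR v) ≡ v
  decodeR-encodeR (b _)  = refl
  decodeR-encodeR (b' _) = refl
  decodeR-encodeR (d _)  = refl
  decodeR-encodeR (d' _) = refl

  _≟L_ : DecidableEquality (LNode n m)
  _≟L_ = via-injection (mk↣ injective) _≟NodeCode_
    where
    injective : ∀ {u u'} → encodeL u ≡ encodeL u' → u ≡ u'
    injective {u} {u'} eq = trans (sym (decodeL-encodeL u)) (trans (cong decodeL eq) (decodeL-encodeL u'))

  _≟R_ : DecidableEquality (RNode n m)
  _≟R_ = via-injection (mk↣ injective) _≟NodeCode_
    where
    injective : ∀ {v v'} → encodeR v ≡ encodeR v' → v ≡ v'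
    injective {v} {v'} eq = trans (sym (decodeR-encodeR v)) (trans (cong decodeR eq) (decodeR-encodeR v'))

  _≟E_ : DecidableEquality (LNode n m × RNode n m)
  (u , v) ≟E (u' , v') with u ≟L u' | v ≟R v'
  ... | yes refl | yes refl = yes refl
  ... | no u≢u'  | _        = no λ { refl → u≢u' refl }
  ... | _        | no v≢v'  = no λ { refl → v≢v' refl }

  allLNodes : List (LNode n m)
  allLNodes = map decodeL ((allOcc n m ⊕ allOcc n m) ⊕ (allVar n ⊕ allVar n))

  ∈-allLNodes : ∀ u → u ∈ allLNodes
  ∈-allLNodes u = subst (_∈ allLNodes) (decodeL-encodeL u) (∈-map⁺ decodeL (complete (encodeL u)))
    where
    complete = ⊕-complete (⊕-complete ∈-allOcc ∈-allOcc) (⊕-complete ∈-allVar ∈-allVar)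

  allLNodes-unique : Unique allLNodes
  allLNodes-unique = Uniqueₚ.map⁺ decodeL-injective
    (⊕-unique (⊕-unique (allOcc-unique n m) (allOcc-unique n m))
              (⊕-unique (allVar-unique n) (allVar-unique n)))
    where
    decodeL-injective : ∀ {k k'} → decodeL k ≡ decodeL k' → k ≡ k'
    decodeL-injective {k} {k'} eq =
      trans (sym (encodeL-decodeL k)) (trans (cong encodeL eq) (encodeL-decodeL k'))

Satisfies : {V : Set} → (V → Bool) → Clause V → Set
Satisfies α C = Any (λ l → α (proj₁ l) ≡ proj₂ l) C

conflicting : {s : Bool} → s ≡ true → s ≡ false → ⊥
conflicting refl ()

module _ {n m : ℕ} (φ : CNF3 n m) where

  posClause∈psi : ∀ ℓ → posClause φ ℓ ∈ psi φ
  posClause∈psi ℓ = ∈-++⁺ˡ (∈-map⁺ (posClause φ) (∈-allFin ℓ))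

  consClause∈psi : ∀ i → consClause i ∈ psi φ
  consClause∈psi i = ∈-++⁺ʳ (map (posClause φ) (allFin m))
    (∈-concatMap⁺ (λ i → consClause i ∷ negClause i ∷ [])
      (Any.map (λ { refl → here refl }) (∈-allFin i)))

  negClause∈psi : ∀ i → negClause i ∈ psi φ
  negClause∈psi i = ∈-++⁺ʳ (map (posClause φ) (allFin m))
    (∈-concatMap⁺ (λ i → consClause i ∷ negClause i ∷ [])
      (Any.map (λ { refl → there (here refl) }) (∈-allFin i)))

  psi-satisfied : ∀ {α} → (∀ ℓ → Satisfies α (posClause φ ℓ)) → (∀ i → Satisfies α (consClause i)) →
                  (∀ i → Satisfies α (negClause i)) → All (Satisfies α) (psi φ)
  psi-satisfied pos cons neg =
    Allₚ.++⁺ (Allₚ.map⁺ (All.universal pos (allFin m)))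
      (Allₚ.concat⁺ (Allₚ.map⁺ (All.universal (λ i → cons i ∷ neg i ∷ []) (allFin n))))

  ∈-occsOf⁻ : ∀ {o x} → o ∈ occsOf φ x → occVar φ o ≡ x
  ∈-occsOf⁻ {x = x} o∈ = proj₂ (∈-filter⁻ (λ o → occVar φ o ≟Var x) {xs = allOcc n m} o∈)

  ∈-occsOf⁺ : ∀ o → o ∈ occsOf φ (occVar φ o)
  ∈-occsOf⁺ o = ∈-filter⁺ (λ o' → occVar φ o' ≟Var occVar φ o) (∈-allOcc o) refl

  occsOf-unique : ∀ x → Unique (occsOf φ x)
  occsOf-unique x = Uniqueₚ.filter⁺ (λ o → occVar φ o ≟Var x) (allOcc-unique n m)

  module _ {σ : Var n → List (Occ n m)} (σ↭ : ∀ x → σ x ↭ occsOf φ x) where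

    ∈-reorder⁻ : ∀ {o x} → o ∈ σ x → occVar φ o ≡ x
    ∈-reorder⁻ {x = x} o∈ = ∈-occsOf⁻ (∈-resp-↭ (σ↭ x) o∈)

    ∈-reorder⁺ : ∀ o → o ∈ σ (occVar φ o)
    ∈-reorder⁺ o = ∈-resp-↭ (↭-sym (σ↭ _)) (∈-occsOf⁺ o)

    reorder-unique : ∀ x → Unique (σ x)
    reorder-unique x = Permutationₛ.Unique-resp-↭ (setoid (Occ n m)) (↭⇒↭ₛ (↭-sym (σ↭ x))) (occsOf-unique x)

module _ {n m : ℕ} where

  a-injective : ∀ {o o' : Occ n m} → a o ≡ a o' → o ≡ o'
  a-injective refl = refl

  b-injective : ∀ {o o' : Occ n m} → b o ≡ b o' → o ≡ o'
  b-injective refl = refl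

  b'-injective : ∀ {o o' : Occ n m} → b' o ≡ b' o' → o ≡ o'
  b'-injective refl = refl

  c-injective : ∀ {x y : Var n} → c {n} {m} x ≡ c y → x ≡ y
  c-injective refl = refl

  d-injective : ∀ {x y : Var n} → d {n} {m} x ≡ d y → x ≡ y
  d-injective refl = refl

module _ {n m : ℕ} where

  gadgetPartnerL : Bool → LNode n m → RNode n m
  gadgetPartnerL true  (a o)  = b' o
  gadgetPartnerL false (a o)  = b o
  gadgetPartnerL true  (a' o) = b o
  gadgetPartnerL false (a' o) = b' o
  gadgetPartnerL true  (c x)  = d x
  gadgetPartnerL false (c x)  = d' x
  gadgetPartnerL true  (c' x) = d' x
  gadgetPartnerL false (c' x) = d x

  gadgetPartnerR : Bool → RNode n m → LNode n m
  gadgetPartnerR true  (b o)  = a' o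
  gadgetPartnerR false (b o)  = a o
  gadgetPartnerR true  (b' o) = a o
  gadgetPartnerR false (b' o) = a' o
  gadgetPartnerR true  (d x)  = c x
  gadgetPartnerR false (d x)  = c' x
  gadgetPartnerR true  (d' x) = c' x
  gadgetPartnerR false (d' x) = c x

  gadgetPartnerR-gadgetPartnerL : ∀ s u → gadgetPartnerR s (gadgetPartnerL s u) ≡ u
  gadgetPartnerR-gadgetPartnerL true  (a _)  = refl
  gadgetPartnerR-gadgetPartnerL false (a _)  = refl
  gadgetPartnerR-gadgetPartnerL true  (a' _) = refl
  gadgetPartnerR-gadgetPartnerL false (a' _) = refl
  gadgetPartnerR-gadgetPartnerL true  (c _)  = refl
  gadgetPartnerR-gadgetPartnerL false (c _)  = refl
  gadgetPartnerR-gadgetPartnerL true  (c' _) = refl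
  gadgetPartnerR-gadgetPartnerL false (c' _) = refl

  gadgetPartnerL-gadgetPartnerR : ∀ s v → gadgetPartnerL s (gadgetPartnerR s v) ≡ v
  gadgetPartnerL-gadgetPartnerR true  (b _)  = refl
  gadgetPartnerL-gadgetPartnerR false (b _)  = refl
  gadgetPartnerL-gadgetPartnerR true  (b' _) = refl
  gadgetPartnerL-gadgetPartnerR false (b' _) = refl
  gadgetPartnerL-gadgetPartnerR true  (d _)  = refl
  gadgetPartnerL-gadgetPartnerR false (d _)  = refl
  gadgetPartnerL-gadgetPartnerR true  (d' _) = refl
  gadgetPartnerL-gadgetPartnerR false (d' _) = refl

does-true⇒ : {P : Set} (p? : Dec P) → does p? ≡ true → P
does-true⇒ (yes p) _ = p

cost≡0⇒witness : {P : Set} (p? : Dec P) → (if does p? then 0 else 1) ≡ 0 → P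
cost≡0⇒witness (yes p) _ = p

diagonal-cost : {A : Set} (_≟_ : DecidableEquality A) (x : A) → (if does (x ≟ x) then 0 else 1) ≡ 0
diagonal-cost _≟_ x = cong (λ t → if t then 0 else 1) (dec-true (x ≟ x) refl)

module _ {n m : ℕ} (φ : CNF3 n m) (σC σD : Var n → List (Occ n m))
         (σC↭ : ∀ x → σC x ↭ occsOf φ x) (σD↭ : ∀ x → σD x ↭ occsOf φ x) where

  open Graph φ σC σD

  ∈-prefL-c⁻ : ∀ {x v} → v ∈ prefL (c x) →
               v ≡ d (bar x) ⊎ v ≡ d x ⊎ (∃[ o ] (o ∈ σC x × v ≡ b' o)) ⊎ v ≡ d' x
  ∈-prefL-c⁻ (here refl)         = inj₁ refl
  ∈-prefL-c⁻ (there (here refl)) = inj₂ (inj₁ refl)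
  ∈-prefL-c⁻ {x} (there (there v∈)) with ∈-++⁻ (map b' (σC x)) v∈
  ... | inj₁ v∈b's with ∈-map⁻ b' v∈b's
  ...   | o , o∈ , refl = inj₂ (inj₂ (inj₁ (o , o∈ , refl)))
  ∈-prefL-c⁻ (there (there v∈)) | inj₂ (here refl) = inj₂ (inj₂ (inj₂ refl))

  ∈-prefR-d'⁻ : ∀ {x u} → u ∈ prefR (d' x) → u ≡ c' x ⊎ (∃[ o ] (o ∈ σD x × u ≡ a o)) ⊎ u ≡ c x
  ∈-prefR-d'⁻ (here refl) = inj₁ refl
  ∈-prefR-d'⁻ {x} (there u∈) with ∈-++⁻ (map a (σD x)) u∈
  ... | inj₁ u∈as with ∈-map⁻ a u∈as
  ...   | o , o∈ , refl = inj₂ (inj₁ (o , o∈ , refl))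
  ∈-prefR-d'⁻ (there u∈) | inj₂ (here refl) = inj₂ (inj₂ refl)

  prefL-unique : ∀ u → Unique (prefL u)
  prefL-unique (a o)  = ((λ eq → prevOcc≢ o (b-injective eq)) ∷ (λ ()) ∷ (λ ()) ∷ [])
                      ∷ ((λ ()) ∷ (λ ()) ∷ []) ∷ ((λ ()) ∷ []) ∷ [] ∷ []
  prefL-unique (a' o) = ((λ ()) ∷ []) ∷ [] ∷ []
  prefL-unique (c x)  = ((λ eq → bar≢ x (d-injective eq)) ∷ no-d) ∷ no-d ∷ tail-unique
    where
    no-d : ∀ {y} → All (d y ≢_) (map b' (σC x) ++ d' x ∷ [])
    no-d = Allₚ.++⁺ (Allₚ.map⁺ (All.tabulate λ _ ())) ((λ ()) ∷ [])
    tail-unique : Unique (map b' (σC x) ++ d' x ∷ [])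
    tail-unique = Uniqueₚ.++⁺ (Uniqueₚ.map⁺ b'-injective (reorder-unique φ σC↭ x)) ([] ∷ [])
      λ { (v∈ , here refl) → All.lookup (Allₚ.map⁺ {P = _≢ d' x} (All.tabulate λ _ ())) v∈ refl }
  prefL-unique (c' x) = ((λ ()) ∷ []) ∷ [] ∷ []

  prefR-unique : ∀ v → Unique (prefR v)
  prefR-unique (b o)  = ((λ eq → nextOcc≢ o (a-injective eq)) ∷ (λ ()) ∷ []) ∷ ((λ ()) ∷ []) ∷ [] ∷ []
  prefR-unique (b' o) = ((λ ()) ∷ (λ ()) ∷ []) ∷ ((λ ()) ∷ []) ∷ [] ∷ []
  prefR-unique (d x)  = ((λ eq → bar≢ x (c-injective eq)) ∷ (λ ()) ∷ []) ∷ ((λ ()) ∷ []) ∷ [] ∷ []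
  prefR-unique (d' x) = no-c' ∷ Uniqueₚ.++⁺ (Uniqueₚ.map⁺ a-injective (reorder-unique φ σD↭ x)) ([] ∷ [])
      λ { (u∈ , here refl) → All.lookup (Allₚ.map⁺ {P = _≢ c x} (All.tabulate λ _ ())) u∈ refl }
    where
    no-c' : All (c' x ≢_) (map a (σD x) ++ c x ∷ [])
    no-c' = Allₚ.++⁺ (Allₚ.map⁺ (All.tabulate λ _ ())) ((λ ()) ∷ [])

  Edge⇒∈prefR : ∀ {u v} → Edge u v → u ∈ prefR v
  Edge⇒∈prefR {a o} (here refl)                         = here (cong a (sym (nextOcc-prevOcc o)))
  Edge⇒∈prefR {a o} (there (here refl))                 = there (here refl)
  Edge⇒∈prefR {a o} (there (there (here refl)))         = there (∈-++⁺ˡ (∈-map⁺ a (∈-reorder⁺ φ σD↭ o)))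
  Edge⇒∈prefR {a o} (there (there (there (here refl)))) = there (there (here refl))
  Edge⇒∈prefR {a' o} (here refl)                        = there (there (here refl))
  Edge⇒∈prefR {a' o} (there (here refl))                = here refl
  Edge⇒∈prefR {c x} v∈ with ∈-prefL-c⁻ v∈
  ... | inj₁ refl                         = here (cong c (sym (bar-involutive x)))
  ... | inj₂ (inj₁ refl)                  = there (here refl)
  ... | inj₂ (inj₂ (inj₁ (o , o∈ , refl))) = there (here (cong c (sym (∈-reorder⁻ φ σC↭ o∈))))
  ... | inj₂ (inj₂ (inj₂ refl))           = there (∈-++⁺ʳ _ (here refl))
  Edge⇒∈prefR {c' x} (here refl)                        = there (there (here refl))
  Edge⇒∈prefR {c' x} (there (here refl))                = here refl

  module _ {N : Matching} (N-matching : IsMatching N) where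

    matched⇒Edge : ∀ {u v} → (u , v) ∈ N → Edge u v
    matched⇒Edge = All.lookup (proj₁ N-matching)

    sameLeft⇒sameRight : ∀ {u v v'} → (u , v) ∈ N → (u , v') ∈ N → v ≡ v'
    sameLeft⇒sameRight uv∈ uv'∈ with AllPairs-lookup (proj₂ N-matching) uv∈ uv'∈
    ... | inj₁ refl             = refl
    ... | inj₂ (inj₁ (u≢u , _)) = contradiction refl u≢u
    ... | inj₂ (inj₂ (u≢u , _)) = contradiction refl u≢u

    sameRight⇒sameLeft : ∀ {u u' v} → (u , v) ∈ N → (u' , v) ∈ N → u ≡ u'
    sameRight⇒sameLeft uv∈ u'v∈ with AllPairs-lookup (proj₂ N-matching) uv∈ u'v∈
    ... | inj₁ refl             = refl
    ... | inj₂ (inj₁ (_ , v≢v)) = contradiction refl v≢v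
    ... | inj₂ (inj₂ (_ , v≢v)) = contradiction refl v≢v

  -- Blocking exchanges

  Unmatchedˡ : Matching → LNode n m → Set
  Unmatchedˡ M u = ∀ v → (u , v) ∉ M

  Unmatchedʳ : Matching → RNode n m → Set
  Unmatchedʳ M v = ∀ u → (u , v) ∉ M

  ImprovesˡOn : Matching → Matching → Set
  ImprovesˡOn A M = ∀ {u w} → (u , w) ∈ A →
    Unmatchedˡ M u ⊎ ∃[ v ] ((u , v) ∈ M × v ∈ map proj₂ A × Before w v (prefL u))

  ImprovesʳOn : Matching → Matching → Set
  ImprovesʳOn A M = ∀ {w v} → (w , v) ∈ A →
    Unmatchedʳ M v ⊎ ∃[ u ] ((u , v) ∈ M × u ∈ map proj₁ A × Before w u (prefR v))

  module Exchange {M A : Matching} (M-matching : IsMatching M) (A-matching : IsMatching A)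
                  (Aˡ : ImprovesˡOn A M) (Aʳ : ImprovesʳOn A M) where

    open DecMembership (_≟L_ {n} {m}) using () renaming (_∈?_ to _∈L?_)
    open DecMembership (_≟R_ {n} {m}) using () renaming (_∈?_ to _∈R?_)

    ∈-lefts⁻ : ∀ {u} → u ∈ map proj₁ A → ∃[ w ] ((u , w) ∈ A)
    ∈-lefts⁻ u∈ with ∈-map⁻ proj₁ u∈
    ... | (_ , w) , uw∈A , refl = w , uw∈A

    ∈-rights⁻ : ∀ {v} → v ∈ map proj₂ A → ∃[ w ] ((w , v) ∈ A)
    ∈-rights⁻ v∈ with ∈-map⁻ proj₂ v∈
    ... | (w , _) , wv∈A , refl = w , wv∈A

    improvesˡ : ∀ {u v w} → (u , w) ∈ A → (u , v) ∈ M → v ∈ map proj₂ A × Before w v (prefL u)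
    improvesˡ uw∈A uv∈M with Aˡ uw∈A
    ... | inj₁ u-free                      = contradiction uv∈M (u-free _)
    ... | inj₂ (_ , uv'∈M , v'∈ , w<v') rewrite sameLeft⇒sameRight M-matching uv∈M uv'∈M = v'∈ , w<v'

    improvesʳ : ∀ {u v w} → (w , v) ∈ A → (u , v) ∈ M → u ∈ map proj₁ A × Before w u (prefR v)
    improvesʳ wv∈A uv∈M with Aʳ wv∈A
    ... | inj₁ v-free                      = contradiction uv∈M (v-free _)
    ... | inj₂ (_ , u'v∈M , u'∈ , w<u') rewrite sameRight⇒sameLeft M-matching uv∈M u'v∈M = u'∈ , w<u'

    outsideA? : (e : LNode n m × RNode n m) → Dec (proj₁ e ∉ map proj₁ A)
    outsideA? e = ¬? (proj₁ e ∈L? map proj₁ A)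

    exchanged : Matching
    exchanged = A ++ filter outsideA? M

    ∈-exchangedᴬ : ∀ {e} → e ∈ A → e ∈ exchanged
    ∈-exchangedᴬ = ∈-++⁺ˡ

    ∈-exchangedᴹ : ∀ {e} → e ∈ M → proj₁ e ∉ map proj₁ A → e ∈ exchanged
    ∈-exchangedᴹ e∈M outside = ∈-++⁺ʳ A (∈-filter⁺ outsideA? e∈M outside)

    ∈-exchangedᴹʳ : ∀ {u v} → (u , v) ∈ M → v ∉ map proj₂ A → (u , v) ∈ exchanged
    ∈-exchangedᴹʳ uv∈M v∉ = ∈-exchangedᴹ uv∈M (λ u∈ → v∉ (proj₁ (improvesˡ (proj₂ (∈-lefts⁻ u∈)) uv∈M)))

    exchanged-matching : IsMatching exchanged
    exchanged-matching =
        Allₚ.++⁺ (proj₁ A-matching) (Allₚ.filter⁺ outsideA? (proj₁ M-matching))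
      , AllPairsₚ.++⁺ (proj₂ A-matching) (AllPairsₚ.filter⁺ outsideA? (proj₂ M-matching))
          (All.tabulate λ e∈A → All.tabulate λ f∈ →
            let f∈M , outside = ∈-filter⁻ outsideA? {xs = M} f∈ in
              (λ eq → outside (subst (_∈ map proj₁ A) eq (∈-map⁺ proj₁ e∈A)))
            , (λ eq → outside (proj₁ (improvesʳ (subst (λ v → (_ , v) ∈ A) eq e∈A) f∈M))))

    exchanged-gains : ∀ {e} → e ∈ A → SomePrefers exchanged M
    exchanged-gains {u , w} uw∈A with Aˡ uw∈A
    ... | inj₁ u-free               = inj₁ (u , inj₁ (w , ∈-exchangedᴬ uw∈A , u-free))
    ... | inj₂ (v , uv∈M , _ , w<v) = inj₁ (u , inj₂ (w , v , ∈-exchangedᴬ uw∈A , uv∈M , w<v))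

    left-loses-nothing : ∀ u → ¬ PrefersL M exchanged u
    left-loses-nothing u (inj₁ (v , uv∈M , u-free)) with u ∈L? map proj₁ A
    ... | yes u∈ = u-free _ (∈-exchangedᴬ (proj₂ (∈-lefts⁻ u∈)))
    ... | no u∉  = u-free v (∈-exchangedᴹ uv∈M u∉)
    left-loses-nothing u (inj₂ (v , w , uv∈M , uw∈X , v<w)) with u ∈L? map proj₁ A
    ... | yes u∈ = let _ , uw'∈A = ∈-lefts⁻ u∈ in
      Before-asym (prefL-unique u)
        (subst (λ w' → Before w' v (prefL u)) (sameLeft⇒sameRight exchanged-matching (∈-exchangedᴬ uw'∈A) uw∈X)
          (proj₂ (improvesˡ uw'∈A uv∈M)))
        v<w
    ... | no u∉  = Before-irrefl (prefL-unique u)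
      (subst (λ w' → Before v w' (prefL u))
        (sym (sameLeft⇒sameRight exchanged-matching (∈-exchangedᴹ uv∈M u∉) uw∈X))
        v<w)
    right-loses-nothing : ∀ v → ¬ PrefersR M exchanged v
    right-loses-nothing v (inj₁ (u , uv∈M , v-free)) with v ∈R? map proj₂ A
    ... | yes v∈ = v-free _ (∈-exchangedᴬ (proj₂ (∈-rights⁻ v∈)))
    ... | no v∉  = v-free u (∈-exchangedᴹʳ uv∈M v∉)
    right-loses-nothing v (inj₂ (u , w , uv∈M , wv∈X , u<w)) with v ∈R? map proj₂ A
    ... | yes v∈ = let _ , w'v∈A = ∈-rights⁻ v∈ in
      Before-asym (prefR-unique v)
        (subst (λ w' → Before w' u (prefR v)) (sameRight⇒sameLeft exchanged-matching (∈-exchangedᴬ w'v∈A) wv∈X)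
          (proj₂ (improvesʳ w'v∈A uv∈M)))
        u<w
    ... | no v∉  = Before-irrefl (prefR-unique v)
      (subst (λ w' → Before u w' (prefR v))
        (sym (sameRight⇒sameLeft exchanged-matching (∈-exchangedᴹʳ uv∈M v∉) wv∈X))
        u<w)

    exchanged-loses-nothing : ¬ SomePrefers M exchanged
    exchanged-loses-nothing (inj₁ (u , M≻X)) = left-loses-nothing u M≻X
    exchanged-loses-nothing (inj₂ (v , M≻X)) = right-loses-nothing v M≻X

  -- Trading M for A on the nodes covered by A gives a matching (A is closed under M-partners)
  -- that these nodes strictly prefer and that every other node keeps unchanged.
  improvement⇒¬ParetoOptimal : ∀ {M A e} → IsMatching A → e ∈ A → ImprovesˡOn A M → ImprovesʳOn A M →
                               ¬ ParetoOptimal M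
  improvement⇒¬ParetoOptimal A-matching e∈A Aˡ Aʳ (M-matching , undominated) =
    undominated (exchanged , exchanged-matching , exchanged-gains e∈A , exchanged-loses-nothing)
    where open Exchange M-matching A-matching Aˡ Aʳ

  ParetoOptimal⇒maximal : ∀ {M u v} → ParetoOptimal M → Unmatchedˡ M u → Unmatchedʳ M v → ¬ Edge u v
  ParetoOptimal⇒maximal M-optimal u-free v-free uv =
    improvement⇒¬ParetoOptimal (uv ∷ [] , [] ∷ []) (here refl)
      (λ { (here refl) → inj₁ u-free }) (λ { (here refl) → inj₁ v-free }) M-optimal

  improving-swap⇒¬ParetoOptimal :
    ∀ {M u₁ u₂ v₁ v₂} → (u₁ , v₁) ∈ M → (u₂ , v₂) ∈ M → u₁ ≢ u₂ → v₂ ≢ v₁ →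
    Before v₂ v₁ (prefL u₁) → Before v₁ v₂ (prefL u₂) →
    Before u₁ u₂ (prefR v₂) → Before u₂ u₁ (prefR v₁) →
    ¬ ParetoOptimal M
  improving-swap⇒¬ParetoOptimal u₁v₁∈M u₂v₂∈M u₁≢u₂ v₂≢v₁ v₂<ˡv₁ v₁<ˡv₂ u₁<ʳu₂ u₂<ʳu₁ =
    improvement⇒¬ParetoOptimal
      ((Before⇒∈ˡ v₂<ˡv₁ ∷ Before⇒∈ˡ v₁<ˡv₂ ∷ []) , (((u₁≢u₂ , v₂≢v₁) ∷ []) ∷ [] ∷ []))
      (here refl)
      (λ { (here refl)         → inj₂ (_ , u₁v₁∈M , there (here refl) , v₂<ˡv₁)
         ; (there (here refl)) → inj₂ (_ , u₂v₂∈M , here refl , v₁<ˡv₂) })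
      (λ { (here refl)         → inj₂ (_ , u₂v₂∈M , there (here refl) , u₁<ʳu₂)
         ; (there (here refl)) → inj₂ (_ , u₁v₁∈M , here refl , u₂<ʳu₁) })

  leftVar : LNode n m → Var n
  leftVar (a o)  = occVar φ o
  leftVar (a' o) = occVar φ o
  leftVar (c x)  = x
  leftVar (c' x) = x

  rightVar : RNode n m → Var n
  rightVar (b o)  = occVar φ o
  rightVar (b' o) = occVar φ o
  rightVar (d x)  = x
  rightVar (d' x) = x

  rightVar-gadgetPartnerL : ∀ s u → rightVar (gadgetPartnerL s u) ≡ leftVar u
  rightVar-gadgetPartnerL true  (a _)  = refl
  rightVar-gadgetPartnerL false (a _)  = refl
  rightVar-gadgetPartnerL true  (a' _) = refl
  rightVar-gadgetPartnerL false (a' _) = refl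
  rightVar-gadgetPartnerL true  (c _)  = refl
  rightVar-gadgetPartnerL false (c _)  = refl
  rightVar-gadgetPartnerL true  (c' _) = refl
  rightVar-gadgetPartnerL false (c' _) = refl

  leftVar-gadgetPartnerR : ∀ s v → leftVar (gadgetPartnerR s v) ≡ rightVar v
  leftVar-gadgetPartnerR true  (b _)  = refl
  leftVar-gadgetPartnerR false (b _)  = refl
  leftVar-gadgetPartnerR true  (b' _) = refl
  leftVar-gadgetPartnerR false (b' _) = refl
  leftVar-gadgetPartnerR true  (d _)  = refl
  leftVar-gadgetPartnerR false (d _)  = refl
  leftVar-gadgetPartnerR true  (d' _) = refl
  leftVar-gadgetPartnerR false (d' _) = refl

  gadgetPartnerL-Edge : ∀ s u → Edge u (gadgetPartnerL s u)
  gadgetPartnerL-Edge true  (a _)  = there (there (there (here refl)))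
  gadgetPartnerL-Edge false (a _)  = there (here refl)
  gadgetPartnerL-Edge true  (a' _) = here refl
  gadgetPartnerL-Edge false (a' _) = there (here refl)
  gadgetPartnerL-Edge true  (c _)  = there (here refl)
  gadgetPartnerL-Edge false (c _)  = there (there (∈-++⁺ʳ _ (here refl)))
  gadgetPartnerL-Edge true  (c' _) = there (here refl)
  gadgetPartnerL-Edge false (c' _) = here refl

  gadgetPartnerL-cost : ∀ s u → cost (u , gadgetPartnerL s u) ≡ 0
  gadgetPartnerL-cost true  (a o)  = diagonal-cost _≟Occ_ o
  gadgetPartnerL-cost false (a o)  = diagonal-cost _≟Occ_ o
  gadgetPartnerL-cost true  (a' o) = diagonal-cost _≟Occ_ o
  gadgetPartnerL-cost false (a' o) = diagonal-cost _≟Occ_ o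
  gadgetPartnerL-cost true  (c x)  = diagonal-cost _≟Var_ x
  gadgetPartnerL-cost false (c x)  = diagonal-cost _≟Var_ x
  gadgetPartnerL-cost true  (c' x) = diagonal-cost _≟Var_ x
  gadgetPartnerL-cost false (c' x) = diagonal-cost _≟Var_ x

  -- From a satisfying assignment to a Pareto-optimal matching of cost 0

  module FromAssignment (α : Var n → Bool) (α⊨ψ : All (Satisfies α) (psi φ)) where

    open ≡-Reasoning

    complementary : ∀ i → α (i , false) ≡ not (α (i , true))
    complementary i with All.lookup α⊨ψ (consClause∈psi φ i) | All.lookup α⊨ψ (negClause∈psi φ i)
    ... | here t         | there (here f) rewrite t | f = refl
    ... | there (here t) | here f         rewrite t | f = refl
    ... | here t         | here f         = ⊥-elim (conflicting t f)
    ... | there (here t) | there (here f) = ⊥-elim (conflicting t f)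

    bar-value : ∀ {x s} → α x ≡ s → α (bar x) ≡ not s
    bar-value {i , true}  refl = complementary i
    bar-value {i , false} refl =
      trans (sym (Boolₚ.not-involutive (α (i , true)))) (cong not (sym (complementary i)))

    posClause-not-all-false : ∀ ℓ j → α (occVar φ (inj₁ (ℓ , j))) ≡ false →
      α (occVar φ (inj₁ (ℓ , next3 j))) ≡ false → α (occVar φ (inj₁ (ℓ , next3 (next3 j)))) ≡ false → ⊥
    posClause-not-all-false ℓ zero             f₀ f₁ f₂ = not-all-false₀ ℓ f₀ f₁ f₂
      where
      not-all-false₀ : ∀ ℓ → α (occVar φ (inj₁ (ℓ , zero))) ≡ false →
        α (occVar φ (inj₁ (ℓ , suc zero))) ≡ false → α (occVar φ (inj₁ (ℓ , suc (suc zero)))) ≡ false → ⊥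
      not-all-false₀ ℓ f₀ f₁ f₂ with All.lookup α⊨ψ (posClause∈psi φ ℓ)
      ... | here t                 = conflicting t f₀
      ... | there (here t)         = conflicting t f₁
      ... | there (there (here t)) = conflicting t f₂
    posClause-not-all-false ℓ (suc zero)       f₁ f₂ f₀ = posClause-not-all-false ℓ zero f₀ f₁ f₂
    posClause-not-all-false ℓ (suc (suc zero)) f₂ f₀ f₁ = posClause-not-all-false ℓ zero f₀ f₁ f₂

    partnerL : LNode n m → RNode n m
    partnerL u = gadgetPartnerL (α (leftVar u)) u

    partnerR : RNode n m → LNode n m
    partnerR v = gadgetPartnerR (α (rightVar v)) v

    partnerR-partnerL : ∀ u → partnerR (partnerL u) ≡ u
    partnerR-partnerL u = begin
      gadgetPartnerR (α (rightVar (gadgetPartnerL s u))) (gadgetPartnerL s u)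
        ≡⟨ cong (λ x → gadgetPartnerR (α x) (gadgetPartnerL s u)) (rightVar-gadgetPartnerL s u) ⟩
      gadgetPartnerR s (gadgetPartnerL s u)
        ≡⟨ gadgetPartnerR-gadgetPartnerL s u ⟩
      u ∎
      where s = α (leftVar u)

    partnerL-partnerR : ∀ v → partnerL (partnerR v) ≡ v
    partnerL-partnerR v = begin
      gadgetPartnerL (α (leftVar (gadgetPartnerR s v))) (gadgetPartnerR s v)
        ≡⟨ cong (λ x → gadgetPartnerL (α x) (gadgetPartnerR s v)) (leftVar-gadgetPartnerR s v) ⟩
      gadgetPartnerL s (gadgetPartnerR s v)
        ≡⟨ gadgetPartnerL-gadgetPartnerR s v ⟩
      v ∎
      where s = α (rightVar v)

    partnerL-injective : ∀ {u u'} → partnerL u ≡ partnerL u' → u ≡ u'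
    partnerL-injective {u} {u'} eq =
      trans (sym (partnerR-partnerL u)) (trans (cong partnerR eq) (partnerR-partnerL u'))

    Mα : Matching
    Mα = map (λ u → u , partnerL u) allLNodes

    ∈Mα⁺ : ∀ u → (u , partnerL u) ∈ Mα
    ∈Mα⁺ u = ∈-map⁺ (λ u → u , partnerL u) (∈-allLNodes u)

    ∈Mα⁺ʳ : ∀ v → (partnerR v , v) ∈ Mα
    ∈Mα⁺ʳ v = subst (λ v' → (partnerR v , v') ∈ Mα) (partnerL-partnerR v) (∈Mα⁺ (partnerR v))

    ∈Mα⁻ : ∀ {u v} → (u , v) ∈ Mα → v ≡ partnerL u
    ∈Mα⁻ uv∈ with ∈-map⁻ (λ u → u , partnerL u) uv∈
    ... | _ , _ , refl = refl

    Mα-matching : IsMatching Mα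
    Mα-matching =
        All.tabulate (λ { {u , v} uv∈ → subst (Edge u) (sym (∈Mα⁻ uv∈)) (gadgetPartnerL-Edge _ u) })
      , AllPairsₚ.map⁺ (AllPairs.map (λ u≢u' → u≢u' , λ eq → u≢u' (partnerL-injective eq)) allLNodes-unique)

    Mα-cost : costM Mα ≡ 0
    Mα-cost = sum-map≡0⁺ cost Mα
      λ { {u , v} uv∈ → subst (λ v → cost (u , v) ≡ 0) (sym (∈Mα⁻ uv∈)) (gadgetPartnerL-cost _ u) }

    module Undominated {N : Matching} (N-matching : IsMatching N) (M≯N : ¬ SomePrefers Mα N) where

      no-left-loss : ∀ {u w s} → α (leftVar u) ≡ s → (u , w) ∈ N → ¬ Before (gadgetPartnerL s u) w (prefL u)
      no-left-loss {u} {w} refl uw∈N v<w = M≯N (inj₁ (u , inj₂ (partnerL u , w , ∈Mα⁺ u , uw∈N , v<w)))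

      no-right-loss : ∀ {v w s} → α (rightVar v) ≡ s → (w , v) ∈ N → ¬ Before (gadgetPartnerR s v) w (prefR v)
      no-right-loss {v} {w} refl wv∈N u<w = M≯N (inj₂ (v , inj₂ (partnerR v , w , ∈Mα⁺ʳ v , wv∈N , u<w)))

      left-matched : ∀ u → ¬ Unmatchedˡ N u
      left-matched u u-free = M≯N (inj₁ (u , inj₁ (partnerL u , ∈Mα⁺ u , u-free)))

      right-matched : ∀ v → ¬ Unmatchedʳ N v
      right-matched v v-free = M≯N (inj₂ (v , inj₁ (partnerR v , ∈Mα⁺ʳ v , v-free)))

      displaced : ∀ {u u' v} → u ≢ u' → (u' , v) ∈ N → (∀ {w} → (u , w) ∈ N → w ≡ v) → Unmatchedˡ N u
      displaced u≢u' u'v∈N forced w uw∈N =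
        u≢u' (sameRight⇒sameLeft N-matching (subst (λ w → (_ , w) ∈ N) (forced uw∈N) uw∈N) u'v∈N)

      c'-stays : ∀ {x v} s → α x ≡ s → (c' x , v) ∈ N → v ≡ gadgetPartnerL s (c' x)
      c'-stays true  αx c'v∈N with matched⇒Edge N-matching c'v∈N
      ... | here refl         = ⊥-elim (no-right-loss αx c'v∈N (there (here (here refl))))
      ... | there (here refl) = refl
      c'-stays false αx c'v∈N with matched⇒Edge N-matching c'v∈N
      ... | here refl         = refl
      ... | there (here refl) = ⊥-elim (no-left-loss αx c'v∈N (here (here refl)))

      c-stays-true : ∀ {x v} → α x ≡ true → (c x , v) ∈ N → v ≡ d x
      c-stays-true {x} αx cv∈N with ∈-prefL-c⁻ (matched⇒Edge N-matching cv∈N)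
      ... | inj₁ refl                          =
        ⊥-elim (left-matched (c' (bar x)) (displaced (λ ()) cv∈N (c'-stays false (bar-value αx))))
      ... | inj₂ (inj₁ refl)                   = refl
      ... | inj₂ (inj₂ (inj₁ (_ , o∈ , refl))) = ⊥-elim (no-left-loss αx cv∈N (there (here (∈-++⁺ˡ (∈-map⁺ b' o∈)))))
      ... | inj₂ (inj₂ (inj₂ refl))            = ⊥-elim (no-left-loss αx cv∈N (there (here (∈-++⁺ʳ _ (here refl)))))

      c-stays : ∀ {x v} s → α x ≡ s → (c x , v) ∈ N → v ≡ gadgetPartnerL s (c x)
      c-stays true αx cv∈N = c-stays-true αx cv∈N
      c-stays {x} false αx cv∈N with ∈-prefL-c⁻ (matched⇒Edge N-matching cv∈N)
      ... | inj₁ refl                          =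
        ⊥-elim (left-matched (c (bar x))
          (displaced (λ eq → bar≢ x (c-injective eq)) cv∈N (c-stays-true (bar-value αx))))
      ... | inj₂ (inj₁ refl)                   = ⊥-elim (left-matched (c' x) (displaced (λ ()) cv∈N (c'-stays false αx)))
      ... | inj₂ (inj₂ (inj₁ (_ , o∈ , refl))) =
        ⊥-elim (no-right-loss (trans (cong α o↦x) αx) cv∈N (here (here (cong c (sym o↦x)))))
        where o↦x = ∈-reorder⁻ φ σC↭ o∈
      ... | inj₂ (inj₂ (inj₂ refl))            = refl

      a'-stays : ∀ {o v} s → α (occVar φ o) ≡ s → (a' o , v) ∈ N → v ≡ gadgetPartnerL s (a' o)
      a'-stays true  αo a'v∈N with matched⇒Edge N-matching a'v∈N
      ... | here refl         = refl
      ... | there (here refl) = ⊥-elim (no-left-loss αo a'v∈N (here (here refl)))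
      a'-stays false αo a'v∈N with matched⇒Edge N-matching a'v∈N
      ... | here refl         = ⊥-elim (no-right-loss αo a'v∈N (there (here (here refl))))
      ... | there (here refl) = refl

      b'-stays : ∀ {o w} s → α (occVar φ o) ≡ s → (w , b' o) ∈ N → w ≡ gadgetPartnerR s (b' o)
      b'-stays s αo wb'∈N with s | Edge⇒∈prefR (matched⇒Edge N-matching wb'∈N)
      ... | true  | here refl                 = contradiction (a'-stays true αo wb'∈N) λ ()
      ... | false | here refl                 = refl
      ... | true  | there (here refl)         = contradiction (c-stays true αo wb'∈N) λ ()
      ... | false | there (here refl)         = contradiction (c-stays false αo wb'∈N) λ ()
      ... | true  | there (there (here refl)) = refl
      ... | false | there (there (here refl)) = ⊥-elim (no-right-loss αo wb'∈N (here (there (here refl))))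

      a-stays-true : ∀ {o v} → α (occVar φ o) ≡ true → (a o , v) ∈ N → v ≡ b' o
      a-stays-true {o} {v} αo av∈N = decidable-stable (v ≟R b' o) λ v≢b'o →
        right-matched (b' o) λ w wb'∈N →
          v≢b'o (sameLeft⇒sameRight N-matching av∈N (subst (λ w → (w , b' o) ∈ N) (b'-stays true αo wb'∈N) wb'∈N))

      -- If a_o is false yet moved to b_{o-1}, then b_o is taken by a_{o+1}, whose variable is false as well.
      shift-propagates : ∀ {o} → (a o , b (prevOcc o)) ∈ N → α (occVar φ o) ≡ false →
        ((a (nextOcc o) , b o) ∈ N → α (occVar φ (nextOcc o)) ≡ false → ⊥) → ⊥
      shift-propagates {o} ab∈N αo continue =
        right-matched (b o) λ w wb∈N → by-partner (Edge⇒∈prefR (matched⇒Edge N-matching wb∈N)) wb∈N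
        where
        by-partner : ∀ {w} → w ∈ prefR (b o) → (w , b o) ∈ N → ⊥
        by-partner (here refl) wb∈N =
          continue wb∈N (Boolₚ.¬-not λ αo' → contradiction (a-stays-true αo' wb∈N) λ ())
        by-partner (there (here refl)) wb∈N =
          prevOcc≢ o (b-injective (sameLeft⇒sameRight N-matching ab∈N wb∈N))
        by-partner (there (there (here refl))) wb∈N = contradiction (a'-stays false αo wb∈N) λ ()

      no-shift : ∀ {o} → (a o , b (prevOcc o)) ∈ N → α (occVar φ o) ≡ false → ⊥
      no-shift {inj₂ (i , p)} ab∈N αo = shift-propagates ab∈N αo λ _ αo' → conflicting (bar-value αo) αo'
      no-shift {o@(inj₁ (ℓ , j))} ab∈N αo = shift-propagates ab∈N αo λ ab∈N' αo' →
        shift-propagates (subst (λ o' → (a (nextOcc o) , b o') ∈ N) (sym (prevOcc-nextOcc o)) ab∈N') αo'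
          λ _ αo'' → posClause-not-all-false ℓ j αo αo' αo''

      a-stays : ∀ {o v} s → α (occVar φ o) ≡ s → (a o , v) ∈ N → v ≡ gadgetPartnerL s (a o)
      a-stays true  αo av∈N = a-stays-true αo av∈N
      a-stays false αo av∈N with matched⇒Edge N-matching av∈N
      ... | here refl                         = ⊥-elim (no-shift av∈N αo)
      ... | there (here refl)                 = refl
      ... | there (there (here refl))         = ⊥-elim (no-left-loss αo av∈N (there (here (here refl))))
      ... | there (there (there (here refl))) = ⊥-elim (no-left-loss αo av∈N (there (here (there (here refl)))))

      stays : ∀ {u v} → (u , v) ∈ N → v ≡ partnerL u
      stays {a _}  = a-stays _ refl
      stays {a' _} = a'-stays _ refl
      stays {c _}  = c-stays _ refl
      stays {c' _} = c'-stays _ refl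

      no-gain : ¬ SomePrefers N Mα
      no-gain (inj₁ (u , inj₁ (_ , _ , u-free))) = u-free (partnerL u) (∈Mα⁺ u)
      no-gain (inj₁ (u , inj₂ (_ , _ , uv∈N , uw∈M , v<w))) =
        Before-irrefl (prefL-unique u) (subst₂ (λ v w → Before v w (prefL u)) (stays uv∈N) (∈Mα⁻ uw∈M) v<w)
      no-gain (inj₂ (v , inj₁ (_ , _ , v-free))) = v-free (partnerR v) (∈Mα⁺ʳ v)
      no-gain (inj₂ (v , inj₂ (u , _ , uv∈N , wv∈M , u<w))) =
        Before-irrefl (prefR-unique v)
          (subst (λ w → Before u w (prefR v)) (partnerL-injective (trans (sym (∈Mα⁻ wv∈M)) (stays uv∈N))) u<w)

    Mα-optimal : ParetoOptimal Mα
    Mα-optimal = Mα-matching , λ (_ , N-matching , N≻M , M≯N) → Undominated.no-gain N-matching M≯N N≻M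

  -- From a Pareto-optimal matching of cost 0 to a satisfying assignment

  module ToAssignment {M : Matching} (M-optimal : ParetoOptimal M) (M-cost : costM M ≡ 0) where

    open DecMembership (_≟E_ {n} {m}) using (_∈?_)

    M-matching : IsMatching M
    M-matching = proj₁ M-optimal

    zero-cost : ∀ {e} → e ∈ M → cost e ≡ 0
    zero-cost = sum-map≡0⁻ cost M-cost

    maximal : ∀ {u v} → Unmatchedˡ M u → Unmatchedʳ M v → ¬ Edge u v
    maximal = ParetoOptimal⇒maximal M-optimal

    a-partner : ∀ {o v} → (a o , v) ∈ M → v ≡ b o ⊎ v ≡ b' o
    a-partner {o} av∈M with matched⇒Edge M-matching av∈M
    ... | here refl                         = ⊥-elim (prevOcc≢ o (sym (cost≡0⇒witness (o ≟Occ _) (zero-cost av∈M))))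
    ... | there (here refl)                 = inj₁ refl
    ... | there (there (here refl))         = contradiction (zero-cost av∈M) λ ()
    ... | there (there (there (here refl))) = inj₂ refl

    b-partner : ∀ {o u} → (u , b o) ∈ M → u ≡ a o ⊎ u ≡ a' o
    b-partner {o} ub∈M with Edge⇒∈prefR (matched⇒Edge M-matching ub∈M)
    ... | here refl                 = ⊥-elim (nextOcc≢ o (cost≡0⇒witness (_ ≟Occ o) (zero-cost ub∈M)))
    ... | there (here refl)         = inj₁ refl
    ... | there (there (here refl)) = inj₂ refl

    b'-partner : ∀ {o u} → (u , b' o) ∈ M → u ≡ a o ⊎ u ≡ a' o
    b'-partner ub'∈M with Edge⇒∈prefR (matched⇒Edge M-matching ub'∈M)
    ... | here refl                 = inj₂ refl
    ... | there (here refl)         = contradiction (zero-cost ub'∈M) λ ()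
    ... | there (there (here refl)) = inj₁ refl

    c-partner : ∀ {x v} → (c x , v) ∈ M → v ≡ d x ⊎ v ≡ d' x
    c-partner {x} cv∈M with ∈-prefL-c⁻ (matched⇒Edge M-matching cv∈M)
    ... | inj₁ refl                       = ⊥-elim (bar≢ x (sym (cost≡0⇒witness (x ≟Var _) (zero-cost cv∈M))))
    ... | inj₂ (inj₁ refl)                = inj₁ refl
    ... | inj₂ (inj₂ (inj₁ (_ , _ , refl))) = contradiction (zero-cost cv∈M) λ ()
    ... | inj₂ (inj₂ (inj₂ refl))         = inj₂ refl

    d-partner : ∀ {x u} → (u , d x) ∈ M → u ≡ c x ⊎ u ≡ c' x
    d-partner {x} ud∈M with Edge⇒∈prefR (matched⇒Edge M-matching ud∈M)
    ... | here refl                 = ⊥-elim (bar≢ x (cost≡0⇒witness (_ ≟Var x) (zero-cost ud∈M)))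
    ... | there (here refl)         = inj₁ refl
    ... | there (there (here refl)) = inj₂ refl

    d'-partner : ∀ {x u} → (u , d' x) ∈ M → u ≡ c x ⊎ u ≡ c' x
    d'-partner ud'∈M with ∈-prefR-d'⁻ (Edge⇒∈prefR (matched⇒Edge M-matching ud'∈M))
    ... | inj₁ refl                  = inj₂ refl
    ... | inj₂ (inj₁ (_ , _ , refl)) = contradiction (zero-cost ud'∈M) λ ()
    ... | inj₂ (inj₂ refl)           = inj₁ refl

    gadget-saturated : ∀ {p p' q q'} → Edge p q → Edge p q' → q ≢ q' →
      (∀ {v} → (p , v) ∈ M → v ≡ q ⊎ v ≡ q') →
      (∀ {u} → (u , q) ∈ M → u ≡ p ⊎ u ≡ p') → (∀ {u} → (u , q') ∈ M → u ≡ p ⊎ u ≡ p') →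
      (p , q) ∈ M ⊎ (p , q') ∈ M
    gadget-saturated {p} {p'} {q} {q'} pq pq' q≢q' p-partner q-partner q'-partner
      with (p , q) ∈? M | (p , q') ∈? M
    ... | yes pq∈M | _         = inj₁ pq∈M
    ... | no _     | yes pq'∈M = inj₂ pq'∈M
    ... | no pq∉M  | no pq'∉M  =
      ⊥-elim (maximal p-free (λ _ uq∈M → maximal p-free (λ _ u'q'∈M →
        q≢q' (sameLeft⇒sameRight M-matching (taken-by-p' q-partner uq∈M) (taken-by-p' q'-partner u'q'∈M)))
        pq') pq)
      where
      p-free : Unmatchedˡ M p
      p-free _ pv∈M with p-partner pv∈M
      ... | inj₁ refl = pq∉M pv∈M
      ... | inj₂ refl = pq'∉M pv∈M

      taken-by-p' : ∀ {r} → (∀ {u} → (u , r) ∈ M → u ≡ p ⊎ u ≡ p') → ∀ {u} → (u , r) ∈ M → (p' , r) ∈ M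
      taken-by-p' r-partner ur∈M with r-partner ur∈M
      ... | inj₁ refl = ⊥-elim (p-free _ ur∈M)
      ... | inj₂ refl = ur∈M

    a-saturated : ∀ o → (a o , b o) ∈ M ⊎ (a o , b' o) ∈ M
    a-saturated o = gadget-saturated (there (here refl)) (there (there (there (here refl)))) (λ ())
      a-partner b-partner b'-partner

    c-saturated : ∀ x → (c x , d x) ∈ M ⊎ (c x , d' x) ∈ M
    c-saturated x = gadget-saturated (there (here refl)) (there (there (∈-++⁺ʳ _ (here refl)))) (λ ())
      c-partner d-partner d'-partner

    α : Var n → Bool
    α x = does ((c x , d x) ∈? M)

    α-true : ∀ {x} → α x ≡ true → (c x , d x) ∈ M
    α-true = does-true⇒ (_ ∈? M)

    α-false : ∀ {x} → α x ≡ false → (c x , d x) ∉ M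
    α-false αx cd∈M = conflicting (dec-true (_ ∈? M) cd∈M) αx

    a-low : ∀ o → α (occVar φ o) ≡ false → (a o , b o) ∈ M
    a-low o αo with a-saturated o | c-saturated (occVar φ o)
    ... | inj₁ ab∈M  | _           = ab∈M
    ... | inj₂ _     | inj₁ cd∈M   = ⊥-elim (α-false αo cd∈M)
    ... | inj₂ ab'∈M | inj₂ cd'∈M  = ⊥-elim (improving-swap⇒¬ParetoOptimal ab'∈M cd'∈M (λ ()) (λ ())
      (there (there (here (here refl))))
      (there (there (Before-++ (map b' (σC x)) (∈-map⁺ b' (∈-reorder⁺ φ σC↭ o)) (here refl))))
      (there (Before-++ (map a (σD x)) (∈-map⁺ a (∈-reorder⁺ φ σD↭ o)) (here refl)))
      (there (here (here refl)))
      M-optimal)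
      where x = occVar φ o

    satisfies? : ∀ C → Dec (Satisfies α C)
    satisfies? C = Any.any? (λ l → α (proj₁ l) Boolₚ.≟ proj₂ l) C

    negClause-satisfied : ∀ i → Satisfies α (negClause i)
    negClause-satisfied i = decidable-stable (satisfies? _) λ unsat →
      improving-swap⇒¬ParetoOptimal (α-true {i , true} (Boolₚ.¬-not λ f → unsat (here f)))
        (α-true {i , false} (Boolₚ.¬-not λ f → unsat (there (here f))))
        (λ ()) (λ ()) (here (here refl)) (here (here refl)) (here (here refl)) (here (here refl)) M-optimal

    consClause-satisfied : ∀ i → Satisfies α (consClause i)
    consClause-satisfied i = decidable-stable (satisfies? _) λ unsat →
      improving-swap⇒¬ParetoOptimal (a-low (inj₂ (i , true)) (Boolₚ.¬-not λ t → unsat (here t)))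
        (a-low (inj₂ (i , false)) (Boolₚ.¬-not λ t → unsat (there (here t))))
        (λ ()) (λ ()) (here (here refl)) (here (here refl)) (here (here refl)) (here (here refl)) M-optimal

    all-low-in-clause : ∀ ℓ → (a (inj₁ (ℓ , zero)) , b (inj₁ (ℓ , zero))) ∈ M →
      (a (inj₁ (ℓ , suc zero)) , b (inj₁ (ℓ , suc zero))) ∈ M →
      (a (inj₁ (ℓ , suc (suc zero))) , b (inj₁ (ℓ , suc (suc zero)))) ∈ M → ⊥
    all-low-in-clause ℓ ab₀∈M ab₁∈M ab₂∈M =
      improvement⇒¬ParetoOptimal {A = (a o₀ , b o₂) ∷ (a o₁ , b o₀) ∷ (a o₂ , b o₁) ∷ []}
        ( (here refl ∷ here refl ∷ here refl ∷ [])
        , ((((λ ()) , (λ ())) ∷ ((λ ()) , (λ ())) ∷ []) ∷ (((λ ()) , (λ ())) ∷ []) ∷ [] ∷ []))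
        (here refl)
        (λ { (here refl)                 → inj₂ (_ , ab₀∈M , there (here refl) , here (here refl))
           ; (there (here refl))         → inj₂ (_ , ab₁∈M , there (there (here refl)) , here (here refl))
           ; (there (there (here refl))) → inj₂ (_ , ab₂∈M , here refl , here (here refl)) })
        (λ { (here refl)                 → inj₂ (_ , ab₂∈M , there (there (here refl)) , here (here refl))
           ; (there (here refl))         → inj₂ (_ , ab₀∈M , here refl , here (here refl))
           ; (there (there (here refl))) → inj₂ (_ , ab₁∈M , there (here refl) , here (here refl)) })
        M-optimal
      where
      o₀ o₁ o₂ : Occ n m
      o₀ = inj₁ (ℓ , zero)
      o₁ = inj₁ (ℓ , suc zero)
      o₂ = inj₁ (ℓ , suc (suc zero))

    posClause-satisfied : ∀ ℓ → Satisfies α (posClause φ ℓ)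
    posClause-satisfied ℓ = decidable-stable (satisfies? _) λ unsat →
      all-low-in-clause ℓ (a-low _ (Boolₚ.¬-not λ t → unsat (here t)))
        (a-low _ (Boolₚ.¬-not λ t → unsat (there (here t))))
        (a-low _ (Boolₚ.¬-not λ t → unsat (there (there (here t)))))

    α-satisfies : All (Satisfies α) (psi φ)
    α-satisfies = psi-satisfied φ posClause-satisfied consClause-satisfied negClause-satisfied

  optimal⇒satisfiable : ∀ {M} → ParetoOptimal M → costM M ≡ 0 → Satisfiable (psi φ)
  optimal⇒satisfiable M-optimal M-cost = α , α-satisfies
    where open ToAssignment M-optimal M-cost

  satisfiable⇒optimal : Satisfiable (psi φ) → ∃[ M ] (ParetoOptimal M × costM M ≡ 0)
  satisfiable⇒optimal (α , α⊨ψ) = Mα , Mα-optimal , Mα-cost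
    where open FromAssignment α α⊨ψ

theorem7 : {n m : ℕ} (φ : CNF3 n m) → DistinctVars φ →
    (σC σD : Var n → List (Occ n m)) →
    (∀ x → σC x ↭ occsOf φ x) → (∀ x → σD x ↭ occsOf φ x) →
    (∃[ M ] (Graph.ParetoOptimal φ σC σD M × Graph.costM φ σC σD M ≡ 0))
      ⇔ Satisfiable (psi φ)
theorem7 φ _ σC σD σC↭ σD↭ =
  mk⇔ (λ (_ , M-optimal , M-cost) → optimal⇒satisfiable φ σC σD σC↭ σD↭ M-optimal M-cost)
      (satisfiable⇒optimal φ σC σD σC↭ σD↭)
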